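{- Let $k\geq 2$ and let $H$ be a $3$-uniform hypergraph on $n$ vertices containing no Berge-$B_k$. Let $G$ be the $2$-shadow of $H$, with each edge of $G$ colored blue if the corresponding pair of vertices lies in more than one hyperedge of $H$ and red otherwise, and let $H_2$ be the set of hyperedges of $H$ containing at least two blue pairs. Then every pair of vertices is contained in at most $2k-2$ hyperedges of $H_2$.
   Context: A hypergraph is $3$-uniform if every hyperedge has exactly $3$ vertices. The $2$-shadow of $H$ is the graph $G$ on $V(H)$ with edge set $\{ab : \{a,b\}\subseteq e \text{ for some } e\in E(H)\}$. For a graph $F$, a hypergraph $H$ contains a Berge-$F$ if there is an injective map $v\mapsto v'$ from $V(F)$ to $V(H)$ and an injective map $\phi$ from $E(F)$ to $E(H)$ such that for every edge $ab$ of $F$, $\{a',b'\}\subseteq\phi(ab)$. The $k$-book $B_k$ is the graph with vertices $u,v,x_1,\dots,x_k$ and edges $uv$, $ux_i$, $vx_i$ ($1\le i\le k$). -}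

module Defs where

open import Data.Nat using (ℕ; _<_; _≤_)
open import Data.Fin using (Fin; toℕ)
open import Data.Fin.Subset using (Subset; _∈_; ∣_∣)
open import Data.Product using (Σ; ∃; _×_; _,_)
open import Relation.Binary.PropositionalEquality using (_≡_; _≢_)
open import Relation.Nullary using (¬_)
open import Function.Definitions using (Injective)

-- A 3-uniform hypergraph on vertex set Fin n: m hyperedges, each a
-- 3-element subset of Fin n, with no repeated hyperedges (E(H) is a set).
record Hypergraph3 (n : ℕ) : Set where
  field
    m       : ℕ
    edge    : Fin m → Subset n
    uniform : ∀ i → ∣ edge i ∣ ≡ 3
    simple  : Injective _≡_ _≡_ edge
open Hypergraph3 public

record Graph : Set₁ where
  field
    V     : Set
    E     : Set
    end₁  : E → V
    end₂  : E → V

BergeIn : ∀ {n} → Graph → Hypergraph3 n → Set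
BergeIn {n} F H =
  Σ (Graph.V F → Fin n) λ f →
  Σ (Graph.E F → Fin (m H)) λ φ →
    Injective _≡_ _≡_ f × Injective _≡_ _≡_ φ ×
    (∀ e → (f (Graph.end₁ F e) ∈ edge H (φ e)) × (f (Graph.end₂ F e) ∈ edge H (φ e)))

data BookV (k : ℕ) : Set where
  bu bv : BookV k
  bx    : Fin k → BookV k

data BookE (k : ℕ) : Set where
  uv : BookE k
  ux : Fin k → BookE k
  vx : Fin k → BookE k

bookEnd₁ : ∀ {k} → BookE k → BookV k
bookEnd₁ uv     = bu
bookEnd₁ (ux i) = bu
bookEnd₁ (vx i) = bv

bookEnd₂ : ∀ {k} → BookE k → BookV k
bookEnd₂ uv     = bv
bookEnd₂ (ux i) = bx i
bookEnd₂ (vx i) = bx i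

Book : ℕ → Graph
Book k = record { V = BookV k ; E = BookE k ; end₁ = bookEnd₁ ; end₂ = bookEnd₂ }

PairIn : ∀ {n} (H : Hypergraph3 n) → Fin n → Fin n → Fin (m H) → Set
PairIn H a b i = (a ∈ edge H i) × (b ∈ edge H i)

Blue : ∀ {n} (H : Hypergraph3 n) → Fin n → Fin n → Set
Blue H a b = (a ≢ b) × Σ (Fin (m H)) λ i → Σ (Fin (m H)) λ j →
  (i ≢ j) × PairIn H a b i × PairIn H a b j

-- Hyperedge i belongs to H₂: it contains at least two distinct blue pairs.
-- Unordered pairs {a,b} are represented by (a,b) with a < b.
InH₂ : ∀ {n} (H : Hypergraph3 n) → Fin (m H) → Set
InH₂ {n} H i = Σ (Fin n) λ a → Σ (Fin n) λ b → Σ (Fin n) λ c → Σ (Fin n) λ d →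
  (toℕ a < toℕ b) × (toℕ c < toℕ d) × ¬ ((a ≡ c) × (b ≡ d)) ×
  PairIn H a b i × PairIn H c d i × Blue H a b × Blue H c d

-- "{a,b} is contained in at most t hyperedges of H₂": every injective family
-- of hyperedges of H₂ containing {a,b} has size at most t.
AtMostInH₂ : ∀ {n} (H : Hypergraph3 n) → Fin n → Fin n → ℕ → Set
AtMostInH₂ H a b t = ∀ (s : ℕ) (g : Fin s → Fin (m H)) → Injective _≡_ _≡_ g →
  (∀ j → InH₂ H (g j) × PairIn H a b (g j)) → s ≤ t

module Submission where

-- Each hyperedge g j of H₂ through ab is {a, b, c j}.  Of its two blue pairs at most one is ab,
-- so some pair a c j or b c j is blue and a second hyperedge h j contains c j and a or b.
-- The c j are distinct, no h j is a g j′, and a hyperedge equals h j for at most two j,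
-- since it would otherwise contain three c's together with a or b.  So 2k − 1 hyperedges g j
-- yield k pages with distinct h's plus a spare g for the spine ab: a Berge-B_k.

open import Defs
open import Data.Bool using (Bool; true; false; not)
open import Data.Bool.Properties using (not-¬)
open import Data.Empty using (⊥; ⊥-elim)
open import Data.Fin using (Fin; zero; suc; _≟_; punchIn; toℕ)
open import Data.Fin.Properties
  using (suc-injective; punchIn-injective; punchInᵢ≢i; any?; all?; ¬∀⟶∃¬; injective⇒≤)
open import Data.Fin.Subset using (Subset; _∈_; ∣_∣; _-_)
open import Data.Fin.Subset.Properties using (x∈p⇒∣p-x∣<∣p∣; x∈p∧x≢y⇒x∈p-y; ⊆-antisym)
open import Data.List using ([]; _∷_; length)
open import Data.List.Relation.Unary.All as All using (All; []; _∷_)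
open import Data.List.Relation.Unary.All.Properties using (¬Any⇒All¬)
open import Data.List.Relation.Unary.AllPairs using ([]; _∷_)
open import Data.List.Relation.Unary.Unique.Propositional using (Unique)
open import Data.Nat using (ℕ; zero; suc; _+_; _*_; _∸_; _≤_; _<_; z≤n; s≤s; _≤?_)
open import Data.Nat.Properties
  using ( ≤-trans; ≤-reflexive; ≤-pred; n≤1+n; +-suc; +-comm; +-identityʳ; +-monoʳ-≤
        ; m+n≤o⇒n≤o; m≤m+n; m∸n+n≡m; <⇒≱; ≰⇒>; <-asym; module ≤-Reasoning)
open import Data.Product using (Σ-syntax; ∃-syntax; _×_; _,_; proj₁; proj₂)
open import Data.Sum using (_⊎_; inj₁; inj₂; [_,_])
import Data.Vec.Functional as Vector
open import Function using (_∘_)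
open import Function.Definitions using (Injective)
open import Relation.Binary.Definitions using (DecidableEquality)
open import Relation.Binary.PropositionalEquality using (_≡_; _≢_; refl; sym; trans; cong; subst; ≢-sym)
open import Relation.Nullary using (¬_; yes; no; contradiction)
open import Relation.Nullary.Decidable using (_⊎-dec_)
import Data.List.Membership.DecPropositional as Membership

module _ {n : ℕ} where
  open Membership (_≟_ {n}) using () renaming (_∈_ to _∈ₗ_; _∈?_ to _∈ₗ?_)

  length≤∣p∣ : ∀ {p : Subset n} {xs} → Unique xs → All (_∈ p) xs → length xs ≤ ∣ p ∣
  length≤∣p∣ [] [] = z≤n
  length≤∣p∣ {p} {x ∷ xs} (x≢xs ∷ xs-unique) (x∈p ∷ xs⊆p) =
    ≤-trans (s≤s (length≤∣p∣ xs-unique xs⊆p-x)) (x∈p⇒∣p-x∣<∣p∣ x∈p)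
    where
    xs⊆p-x : All (_∈ p - x) xs
    xs⊆p-x = All.zipWith (λ (y∈p , x≢y) → x∈p∧x≢y⇒x∈p-y y∈p (≢-sym x≢y)) (xs⊆p , x≢xs)

  ∣p∣≤length⇒⊆ : ∀ {p : Subset n} {xs} → ∣ p ∣ ≤ length xs → Unique xs → All (_∈ p) xs →
                 ∀ {x} → x ∈ p → x ∈ₗ xs
  ∣p∣≤length⇒⊆ {xs = xs} ∣p∣≤ xs-unique xs⊆p {x} x∈p with x ∈ₗ? xs
  ... | yes x∈xs = x∈xs
  ... | no x∉xs =
    contradiction ∣p∣≤ (<⇒≱ (length≤∣p∣ (¬Any⇒All¬ xs x∉xs ∷ xs-unique) (x∈p ∷ xs⊆p)))

  ∣p∣≤length⇒≡ : ∀ {p q : Subset n} {xs} → ∣ p ∣ ≤ length xs → ∣ q ∣ ≤ length xs → Unique xs →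
                 All (_∈ p) xs → All (_∈ q) xs → p ≡ q
  ∣p∣≤length⇒≡ ∣p∣≤ ∣q∣≤ xs-unique xs⊆p xs⊆q =
    ⊆-antisym (All.lookup xs⊆q ∘ ∣p∣≤length⇒⊆ ∣p∣≤ xs-unique xs⊆p)
              (All.lookup xs⊆p ∘ ∣p∣≤length⇒⊆ ∣q∣≤ xs-unique xs⊆q)

suc+suc≤⇒+≤ : ∀ {k t} → suc k + suc k ≤ suc (suc t) → k + k ≤ t
suc+suc≤⇒+≤ {k} {t} le = ≤-pred (subst (_≤ suc t) (+-suc k k) (≤-pred le))

AtMostTwoToOne : ∀ {a} {A : Set a} {t} → (Fin t → A) → Set a
AtMostTwoToOne f = ∀ {i j l} → i ≢ j → j ≢ l → i ≢ l → f i ≡ f j → f j ≡ f l → ⊥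

module _ {a} {A : Set a} where

  atMostTwoToOne-∘ : ∀ {t u} {f : Fin t → A} {ρ : Fin u → Fin t} →
                     AtMostTwoToOne f → Injective _≡_ _≡_ ρ → AtMostTwoToOne (f ∘ ρ)
  atMostTwoToOne-∘ f-2to1 ρ-injective i≢j j≢l i≢l =
    f-2to1 (i≢j ∘ ρ-injective) (j≢l ∘ ρ-injective) (i≢l ∘ ρ-injective)

  zero∷-injective : ∀ {t k} (f : Fin (suc t) → A) (r : Fin k → Fin (suc t)) →
                    Injective _≡_ _≡_ (f ∘ r) → (∀ i → f (r i) ≢ f zero) →
                    Injective _≡_ _≡_ (f ∘ (zero Vector.∷ r))
  zero∷-injective f r fr-injective fresh {zero}  {zero}  _ = refl
  zero∷-injective f r fr-injective fresh {zero}  {suc j} e = contradiction (sym e) (fresh j)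
  zero∷-injective f r fr-injective fresh {suc i} {zero}  e = contradiction e (fresh i)
  zero∷-injective f r fr-injective fresh {suc i} {suc j} e = cong suc (fr-injective e)

  -- Greedy: keep index 0 and discard the (at most one) other index carrying its value.
  atMostTwoToOne⇒injective-restriction :
    DecidableEquality A → ∀ k {t} (f : Fin t → A) → AtMostTwoToOne f → k + k ≤ suc t →
    Σ[ q ∈ (Fin k → Fin t) ] Injective _≡_ _≡_ (f ∘ q)
  atMostTwoToOne⇒injective-restriction _ zero f _ _ = (λ ()) , λ { {()} }
  atMostTwoToOne⇒injective-restriction _ (suc k) {zero} f _ 2k≤1 =
    contradiction (m+n≤o⇒n≤o k (≤-pred 2k≤1)) λ ()
  atMostTwoToOne⇒injective-restriction _≟ᴬ_ (suc k) {suc t} f f-2to1 2k≤2+t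
    with any? (λ i → f (suc i) ≟ᴬ f zero)
  ... | no fresh =
    let q , fq-injective = atMostTwoToOne⇒injective-restriction _≟ᴬ_ k (f ∘ suc)
                             (atMostTwoToOne-∘ f-2to1 suc-injective)
                             (≤-trans (suc+suc≤⇒+≤ 2k≤2+t) (n≤1+n t))
    in zero Vector.∷ (suc ∘ q) , zero∷-injective f (suc ∘ q) fq-injective (λ i e → fresh (q i , e))
  atMostTwoToOne⇒injective-restriction _≟ᴬ_ (suc k) {suc (suc t)} f f-2to1 2k≤2+t
    | yes (i₀ , fi₀≡f0) =
    let q , fq-injective = atMostTwoToOne⇒injective-restriction _≟ᴬ_ k (f ∘ suc ∘ punchIn i₀)
                             (atMostTwoToOne-∘ f-2to1 (punchIn-injective i₀ _ _ ∘ suc-injective))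
                             (suc+suc≤⇒+≤ 2k≤2+t)
        r = suc ∘ punchIn i₀ ∘ q
    in zero Vector.∷ r , zero∷-injective f r fq-injective (third-copy ∘ q)
    where
    third-copy : ∀ j → f (suc (punchIn i₀ j)) ≢ f zero
    third-copy j e = f-2to1 {zero} {suc i₀} {suc (punchIn i₀ j)} (λ ())
      (punchInᵢ≢i i₀ j ∘ sym ∘ suc-injective) (λ ()) (sym fi₀≡f0) (trans fi₀≡f0 (sym e))
  atMostTwoToOne⇒injective-restriction _ (suc k) {suc zero} f _ _ | yes (() , _)

∃-outside-image : ∀ {k s} → k < s → (q : Fin k → Fin s) → ∃[ t ] ∀ i → q i ≢ t
∃-outside-image {k} {s} k<s q with all? (λ t → any? (λ i → q i ≟ t))
... | yes covered = contradiction (injective⇒≤ preimage-injective) (<⇒≱ k<s)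
  where
  preimage-injective : Injective _≡_ _≡_ (λ t → proj₁ (covered t))
  preimage-injective {t} {t′} e =
    trans (sym (proj₂ (covered t))) (trans (cong q e) (proj₂ (covered t′)))
... | no uncovered =
  let t , t∉q = ¬∀⟶∃¬ s _ (λ t → any? (λ i → q i ≟ t)) uncovered in t , λ i e → t∉q (i , e)

module _ {n : ℕ} (H : Hypergraph3 n) where

  private
    E = edge H
    ∣E∣≤3 : ∀ i → ∣ E i ∣ ≤ 3
    ∣E∣≤3 i = ≤-reflexive (uniform H i)

  no-four-in-edge : ∀ i {x y z w} → Unique (x ∷ y ∷ z ∷ w ∷ []) →
                    All (_∈ E i) (x ∷ y ∷ z ∷ w ∷ []) → ⊥
  no-four-in-edge i distinct ⊆E = contradiction (length≤∣p∣ distinct ⊆E) (<⇒≱ (s≤s (∣E∣≤3 i)))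

  edge-determined-by-triple : ∀ {i i′ x y z} → Unique (x ∷ y ∷ z ∷ []) →
    All (_∈ E i) (x ∷ y ∷ z ∷ []) → All (_∈ E i′) (x ∷ y ∷ z ∷ []) → i ≡ i′
  edge-determined-by-triple {i} {i′} distinct ⊆E ⊆E′ =
    simple H (∣p∣≤length⇒≡ (∣E∣≤3 i) (∣E∣≤3 i′) distinct ⊆E ⊆E′)

Blue-sym : ∀ {n} {H : Hypergraph3 n} {p q} → Blue H p q → Blue H q p
Blue-sym (p≢q , i , j , i≢j , (p∈i , q∈i) , (p∈j , q∈j)) =
  ≢-sym p≢q , i , j , i≢j , (q∈i , p∈i) , (q∈j , p∈j)

module Pages {n} (H : Hypergraph3 n) {a b : Fin n} (a≢b : a ≢ b)
  {s} (g : Fin s → Fin (m H)) (g-injective : Injective _≡_ _≡_ g)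
  (g∈H₂ : ∀ j → InH₂ H (g j)) (ab⊆g : ∀ j → PairIn H a b (g j)) where

  private
    E = edge H

  End : Fin n → Set
  End x = (x ≡ a) ⊎ (x ≡ b)

  Spine : Fin n → Fin n → Set
  Spine p q = ((p ≡ a) × (q ≡ b)) ⊎ ((p ≡ b) × (q ≡ a))

  record Page (j : Fin s) : Set where
    field
      c       : Fin n
      c≢a     : c ≢ a
      c≢b     : c ≢ b
      c∈g     : c ∈ E (g j)
      h       : Fin (m H)
      h≢g     : h ≢ g j
      c∈h     : c ∈ E h
      a∈h⊎b∈h : (a ∈ E h) ⊎ (b ∈ E h)

  a∈g : ∀ j → a ∈ E (g j)
  a∈g j = proj₁ (ab⊆g j)

  b∈g : ∀ j → b ∈ E (g j)
  b∈g j = proj₂ (ab⊆g j)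

  end∈ : ∀ {w i} → End w → w ∈ E i → (a ∈ E i) ⊎ (b ∈ E i)
  end∈ (inj₁ refl) w∈i = inj₁ w∈i
  end∈ (inj₂ refl) w∈i = inj₂ w∈i

  page-from-blue : ∀ j {x w} → x ∈ E (g j) → ¬ End x → End w → Blue H x w → Page j
  page-from-blue j {x} x∈g x∉ab w∈ab (_ , i₁ , i₂ , i₁≢i₂ , (x∈i₁ , w∈i₁) , (x∈i₂ , w∈i₂))
    with i₁ ≟ g j
  ... | no i₁≢g = record
    { c = x ; c≢a = x∉ab ∘ inj₁ ; c≢b = x∉ab ∘ inj₂ ; c∈g = x∈g
    ; h = i₁ ; h≢g = i₁≢g ; c∈h = x∈i₁ ; a∈h⊎b∈h = end∈ w∈ab w∈i₁ }
  ... | yes refl = record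
    { c = x ; c≢a = x∉ab ∘ inj₁ ; c≢b = x∉ab ∘ inj₂ ; c∈g = x∈g
    ; h = i₂ ; h≢g = i₁≢i₂ ∘ sym ; c∈h = x∈i₂ ; a∈h⊎b∈h = end∈ w∈ab w∈i₂ }

  both-ends⇒Spine : ∀ {p q} → p ≢ q → End p → End q → Spine p q
  both-ends⇒Spine p≢q (inj₁ refl) (inj₁ refl) = contradiction refl p≢q
  both-ends⇒Spine _   (inj₁ refl) (inj₂ refl) = inj₁ (refl , refl)
  both-ends⇒Spine _   (inj₂ refl) (inj₁ refl) = inj₂ (refl , refl)
  both-ends⇒Spine p≢q (inj₂ refl) (inj₂ refl) = contradiction refl p≢q

  blue-pair : ∀ j {p q} → p ∈ E (g j) → q ∈ E (g j) → Blue H p q → Page j ⊎ Spine p q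
  blue-pair j {p} {q} p∈g q∈g blue with (p ≟ a) ⊎-dec (p ≟ b) | (q ≟ a) ⊎-dec (q ≟ b)
  ... | yes p∈ab | yes q∈ab = inj₂ (both-ends⇒Spine (proj₁ blue) p∈ab q∈ab)
  ... | yes p∈ab | no q∉ab  = inj₁ (page-from-blue j q∈g q∉ab p∈ab (Blue-sym {H = H} blue))
  ... | no p∉ab  | yes q∈ab = inj₁ (page-from-blue j p∈g p∉ab q∈ab blue)
  ... | no p∉ab  | no q∉ab  = ⊥-elim (no-four-in-edge H (g j)
    ((a≢b ∷ ≢-sym (p∉ab ∘ inj₁) ∷ ≢-sym (q∉ab ∘ inj₁) ∷ []) ∷
     (≢-sym (p∉ab ∘ inj₂) ∷ ≢-sym (q∉ab ∘ inj₂) ∷ []) ∷ (proj₁ blue ∷ []) ∷ [] ∷ [])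
    (a∈g j ∷ b∈g j ∷ p∈g ∷ q∈g ∷ []))

  -- The two blue pairs of g j are distinct and written in increasing order, so they cannot both be ab.
  distinct-spines : ∀ {p q r t} → toℕ p < toℕ q → toℕ r < toℕ t → ¬ ((p ≡ r) × (q ≡ t)) →
                    Spine p q → Spine r t → ⊥
  distinct-spines _   _   pq≢rt (inj₁ (refl , refl)) (inj₁ (refl , refl)) = pq≢rt (refl , refl)
  distinct-spines p<q r<t _     (inj₁ (refl , refl)) (inj₂ (refl , refl)) = <-asym p<q r<t
  distinct-spines p<q r<t _     (inj₂ (refl , refl)) (inj₁ (refl , refl)) = <-asym p<q r<t
  distinct-spines _   _   pq≢rt (inj₂ (refl , refl)) (inj₂ (refl , refl)) = pq≢rt (refl , refl)

  page : ∀ j → Page j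
  page j with g∈H₂ j
  ... | p , q , r , t , p<q , r<t , pq≢rt , (p∈g , q∈g) , (r∈g , t∈g) , blue₁ , blue₂
    with blue-pair j p∈g q∈g blue₁ | blue-pair j r∈g t∈g blue₂
  ... | inj₁ pg       | _             = pg
  ... | inj₂ _        | inj₁ pg       = pg
  ... | inj₂ pq-spine | inj₂ rt-spine = ⊥-elim (distinct-spines p<q r<t pq≢rt pq-spine rt-spine)

  module PageOf j = Page (page j)
  open PageOf public

  abc-distinct : ∀ j → Unique (a ∷ b ∷ c j ∷ [])
  abc-distinct j = (a≢b ∷ ≢-sym (c≢a j) ∷ []) ∷ (≢-sym (c≢b j) ∷ []) ∷ [] ∷ []

  c-injective : Injective _≡_ _≡_ c
  c-injective {j} {j′} cj≡cj′ = g-injective (edge-determined-by-triple H (abc-distinct j)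
    (a∈g j ∷ b∈g j ∷ c∈g j ∷ [])
    (a∈g j′ ∷ b∈g j′ ∷ subst (_∈ E (g j′)) (sym cj≡cj′) (c∈g j′) ∷ []))

  h≢g′ : ∀ j j′ → h j ≢ g j′
  h≢g′ j j′ hj≡gj′ = h≢g j (edge-determined-by-triple H (abc-distinct j)
    (subst (λ i → a ∈ E i) (sym hj≡gj′) (a∈g j′) ∷
     subst (λ i → b ∈ E i) (sym hj≡gj′) (b∈g j′) ∷ c∈h j ∷ [])
    (a∈g j ∷ b∈g j ∷ c∈g j ∷ []))

  h-atMostTwoToOne : AtMostTwoToOne h
  h-atMostTwoToOne {j₁} {j₂} {j₃} j₁≢j₂ j₂≢j₃ j₁≢j₃ h₁≡h₂ h₂≡h₃ =
    [ four-in-h₁ (c≢a j₁) (c≢a j₂) (c≢a j₃) , four-in-h₁ (c≢b j₁) (c≢b j₂) (c≢b j₃) ] (a∈h⊎b∈h j₁)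
    where
    c₂∈h₁ : c j₂ ∈ E (h j₁)
    c₂∈h₁ = subst (λ i → c j₂ ∈ E i) (sym h₁≡h₂) (c∈h j₂)
    c₃∈h₁ : c j₃ ∈ E (h j₁)
    c₃∈h₁ = subst (λ i → c j₃ ∈ E i) (sym (trans h₁≡h₂ h₂≡h₃)) (c∈h j₃)
    four-in-h₁ : ∀ {w} → c j₁ ≢ w → c j₂ ≢ w → c j₃ ≢ w → w ∈ E (h j₁) → ⊥
    four-in-h₁ c₁≢w c₂≢w c₃≢w w∈h₁ = no-four-in-edge H (h j₁)
      ((j₁≢j₂ ∘ c-injective ∷ j₁≢j₃ ∘ c-injective ∷ c₁≢w ∷ []) ∷
       (j₂≢j₃ ∘ c-injective ∷ c₂≢w ∷ []) ∷ (c₃≢w ∷ []) ∷ [] ∷ [])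
      (c∈h j₁ ∷ c₂∈h₁ ∷ c₃∈h₁ ∷ w∈h₁ ∷ [])

  spoke : Fin s → Bool → Fin (m H)
  spoke j false = g j
  spoke j true  = h j

  c∈spoke : ∀ j β → c j ∈ E (spoke j β)
  c∈spoke j false = c∈g j
  c∈spoke j true  = c∈h j

  a-spoke : ∀ j → Σ[ β ∈ Bool ] (a ∈ E (spoke j β)) × (b ∈ E (spoke j (not β)))
  a-spoke j with a∈h⊎b∈h j
  ... | inj₁ a∈h = true , a∈h , b∈g j
  ... | inj₂ b∈h = false , a∈g j , b∈h

  module _ {k} (q : Fin k → Fin s) (hq-injective : Injective _≡_ _≡_ (h ∘ q)) where

    q-injective : Injective _≡_ _≡_ q
    q-injective = hq-injective ∘ cong h

    spoke-injective : ∀ i i′ β β′ → spoke (q i) β ≡ spoke (q i′) β′ → (i ≡ i′) × (β ≡ β′)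
    spoke-injective _ _ false false e = q-injective (g-injective e) , refl
    spoke-injective _ _ false true  e = contradiction (sym e) (h≢g′ _ _)
    spoke-injective _ _ true  false e = contradiction e (h≢g′ _ _)
    spoke-injective _ _ true  true  e = hq-injective e , refl

    g≢spoke : ∀ {t} → (∀ i → q i ≢ t) → ∀ i β → g t ≢ spoke (q i) β
    g≢spoke t∉q i false = t∉q i ∘ sym ∘ g-injective
    g≢spoke t∉q i true  = h≢g′ _ _ ∘ sym

    book : ∀ t → (∀ i → q i ≢ t) → BergeIn (Book k) H
    book t t∉q = f , φ , f-injective , φ-injective , incidence
      where
      β : Fin k → Bool
      β i = proj₁ (a-spoke (q i))

      f : BookV k → Fin n
      f bu     = a
      f bv     = b
      f (bx i) = c (q i)

      φ : BookE k → Fin (m H)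
      φ uv     = g t
      φ (ux i) = spoke (q i) (β i)
      φ (vx i) = spoke (q i) (not (β i))

      f-injective : Injective _≡_ _≡_ f
      f-injective {bu}   {bu}    _ = refl
      f-injective {bu}   {bv}    e = contradiction e a≢b
      f-injective {bu}   {bx i}  e = contradiction (sym e) (c≢a (q i))
      f-injective {bv}   {bu}    e = contradiction (sym e) a≢b
      f-injective {bv}   {bv}    _ = refl
      f-injective {bv}   {bx i}  e = contradiction (sym e) (c≢b (q i))
      f-injective {bx i} {bu}    e = contradiction e (c≢a (q i))
      f-injective {bx i} {bv}    e = contradiction e (c≢b (q i))
      f-injective {bx i} {bx i′} e = cong bx (q-injective (c-injective e))

      φ-injective : Injective _≡_ _≡_ φ
      φ-injective {uv}   {uv}    _ = refl
      φ-injective {uv}   {ux i}  e = contradiction e (g≢spoke t∉q i (β i))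
      φ-injective {uv}   {vx i}  e = contradiction e (g≢spoke t∉q i (not (β i)))
      φ-injective {ux i} {uv}    e = contradiction (sym e) (g≢spoke t∉q i (β i))
      φ-injective {vx i} {uv}    e = contradiction (sym e) (g≢spoke t∉q i (not (β i)))
      φ-injective {ux i} {ux i′} e = cong ux (proj₁ (spoke-injective i i′ (β i) (β i′) e))
      φ-injective {vx i} {vx i′} e = cong vx (proj₁ (spoke-injective i i′ (not (β i)) (not (β i′)) e))
      φ-injective {ux i} {vx i′} e with spoke-injective i i′ (β i) (not (β i′)) e
      ... | refl , β≡¬β = contradiction β≡¬β (not-¬ refl)
      φ-injective {vx i} {ux i′} e with spoke-injective i i′ (not (β i)) (β i′) e
      ... | refl , ¬β≡β = contradiction (sym ¬β≡β) (not-¬ refl)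

      incidence : ∀ e → (f (bookEnd₁ e) ∈ E (φ e)) × (f (bookEnd₂ e) ∈ E (φ e))
      incidence uv     = a∈g t , b∈g t
      incidence (ux i) = proj₁ (proj₂ (a-spoke (q i))) , c∈spoke (q i) (β i)
      incidence (vx i) = proj₂ (proj₂ (a-spoke (q i))) , c∈spoke (q i) (not (β i))

2k∸2<s⇒k+k≤1+s : ∀ {k s} → 2 ≤ k → 2 * k ∸ 2 < s → k + k ≤ suc s
2k∸2<s⇒k+k≤1+s {k} {s} 2≤k 2k∸2<s = begin
  k + k                 ≡⟨ cong (k +_) (sym (+-identityʳ k)) ⟩
  2 * k                 ≡⟨ sym (m∸n+n≡m (≤-trans 2≤k (m≤m+n k (k + 0)))) ⟩
  2 * k ∸ 2 + 2         ≡⟨ +-comm (2 * k ∸ 2) 2 ⟩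
  suc (suc (2 * k ∸ 2)) ≤⟨ s≤s 2k∸2<s ⟩
  suc s                 ∎
  where open ≤-Reasoning

k+k≤1+s⇒k<s : ∀ {k s} → 2 ≤ k → k + k ≤ suc s → k < s
k+k≤1+s⇒k<s {k} {s} 2≤k k+k≤1+s = ≤-pred (begin
  suc (suc k) ≡⟨ +-comm 2 k ⟩
  k + 2       ≤⟨ +-monoʳ-≤ k 2≤k ⟩
  k + k       ≤⟨ k+k≤1+s ⟩
  suc s       ∎)
  where open ≤-Reasoning

lemma2 : (k n : ℕ) → 2 ≤ k → (H : Hypergraph3 n) → ¬ BergeIn (Book k) H →
    (a b : Fin n) → a ≢ b → AtMostInH₂ H a b (2 * k ∸ 2)
lemma2 k n 2≤k H no-book a b a≢b s g g-injective g∈H₂∩ab with s ≤? 2 * k ∸ 2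
... | yes s≤2k∸2 = s≤2k∸2
... | no s≰2k∸2 =
  let k+k≤1+s          = 2k∸2<s⇒k+k≤1+s 2≤k (≰⇒> s≰2k∸2)
      q , hq-injective = atMostTwoToOne⇒injective-restriction _≟_ k h h-atMostTwoToOne k+k≤1+s
      t , t∉q          = ∃-outside-image (k+k≤1+s⇒k<s 2≤k k+k≤1+s) q
  in ⊥-elim (no-book (book q hq-injective t t∉q))
  where open Pages H a≢b g g-injective (proj₁ ∘ g∈H₂∩ab) (proj₂ ∘ g∈H₂∩ab)
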